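{- Define pairs of numbers $(p_k,q_k)$, $k\ge 0$, by $(p_0,q_0)=(0,1)$ and $$p_{k+1}=\frac{2+p_kq_k}{q_k-2p_k},\qquad q_{k+1}=\frac{4+q_k^2}{q_k-2p_k}\qquad (k\ge 0),$$ i.e. $(p_{k+1},q_{k+1})$ is the Springborn mediant of $(p_k,q_k)$ and $(1,2)$ (this is the bottom left branch $\frac{2}{5},\frac{12}{29},\frac{70}{169},\frac{408}{985},\dots$ of the Markov fraction tree). Let $(y_n)_{n\ge1}$ be the Pell numbers, $y_1=1$, $y_2=2$, $y_{n+1}=2y_n+y_{n-1}$. Then for every $k\ge 1$, $$\frac{p_k}{q_k}=\frac{y_{2k}}{y_{2k+1}},$$ with $p_k=y_{2k}$ and $q_k=y_{2k+1}$.
   Context: The Springborn mediant of integer pairs $(p_1,q_1)$, $(p_2,q_2)$ with $p_1/q_1<p_2/q_2$ is the pair $\left(\frac{p_1q_1+p_2q_2}{p_2q_1-p_1q_2},\ \frac{q_1^2+q_2^2}{p_2q_1-p_1q_2}\right)$. The Pell numbers $y_n$ are the second coordinates of the positive solutions $(x_n,y_n)$ of $x^2-2y^2=(-1)^n$: $1,2,5,12,29,70,169,408,985,\dots$ -}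

module Defs where

open import Data.Nat as ℕ using (ℕ; zero; suc)
open import Data.Rational as ℚ using (ℚ; 0ℚ; _+_; _*_; _-_; _÷_; ≢-nonZero)
open import Data.Rational.Properties using (_≟_)
open import Data.Integer using (+_)
open import Relation.Nullary using (yes; no)

⟦_⟧ : ℕ → ℚ
⟦ n ⟧ = + n ℚ./ 1

-- total division on ℚ: x / y when y ≠ 0 (junk value 0 when y = 0;
-- never used in the statement since denominators turn out nonzero)
_//_ : ℚ → ℚ → ℚ
x // y with y ≟ 0ℚ
... | yes _ = 0ℚ
... | no y≢0 = _÷_ x y {{≢-nonZero y≢0}}

record Pair : Set where
  constructor ⟨_,_⟩
  field
    fst snd : ℚ

mediant : Pair → Pair → Pair
mediant ⟨ p₁ , q₁ ⟩ ⟨ p₂ , q₂ ⟩ =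
  ⟨ (p₁ * q₁ + p₂ * q₂) // (p₂ * q₁ - p₁ * q₂)
  , (q₁ * q₁ + q₂ * q₂) // (p₂ * q₁ - p₁ * q₂) ⟩

pq : ℕ → Pair
pq zero = ⟨ ⟦ 0 ⟧ , ⟦ 1 ⟧ ⟩
pq (suc k) = mediant (pq k) ⟨ ⟦ 1 ⟧ , ⟦ 2 ⟧ ⟩

p : ℕ → ℚ
p k = Pair.fst (pq k)

q : ℕ → ℚ
q k = Pair.snd (pq k)

y : ℕ → ℕ
y zero = 0
y (suc zero) = 1
y (suc (suc n)) = 2 ℕ.* y (suc n) ℕ.+ y n

-- Two Pell steps (a, b) ↦ (2b + a, 2(2b + a) + b) preserve the Cassini form
-- b² − 2ab − a², and on pairs where this form is 1 the Springborn mediant with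
-- (1, 2) performs exactly these two steps: its denominator is d = b − 2a, and
-- ab + 2 = (2b + a) d and b² + 4 = (5b + 2a) d are the Cassini identity in
-- disguise.  Since (p₀, q₀) = (y₀, y₁) has Cassini form 1, induction gives
-- (p_k, q_k) = (y_{2k}, y_{2k+1}).
module Submission where

open import Defs
open import Data.Nat using (ℕ; _≤_; _*_; _+_)
open import Data.Product using (_×_)
open import Relation.Binary.PropositionalEquality using (_≡_)

open import Data.Nat using (zero; suc)
import Data.Nat.Properties as ℕ
open import Data.Integer using (+_)
import Data.Integer.Properties as ℤ
open import Data.Integer.Tactic.RingSolver using (solve-∀)
import Data.Integer as ℤ
open import Data.Product using (_,_)
open import Data.Sum using (inj₁; inj₂)
open import Data.Empty using (⊥-elim)
open import Relation.Nullary using (yes; no)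
open import Data.Rational as ℚ using (ℚ; 0ℚ; 1ℚ; NonNegative; toℚᵘ)
open import Data.Rational.Properties
import Data.Rational.Unnormalised as ℚᵘ
import Data.Rational.Unnormalised.Properties as ℚᵘ
open import Data.Rational.Solver using (module +-*-Solver)
open +-*-Solver using (solve; _:=_; con; _:+_; _:*_; _:-_; Polynomial)
open import Relation.Binary.PropositionalEquality
  using (refl; sym; trans; cong; cong₂; _≢_; module ≡-Reasoning)

toℚᵘ-⟦⟧ : ∀ n → toℚᵘ ⟦ n ⟧ ℚᵘ.≃ ℚᵘ.mkℚᵘ (+ n) 0
toℚᵘ-⟦⟧ n = toℚᵘ-fromℚᵘ (ℚᵘ.mkℚᵘ (+ n) 0)

⟦⟧-homo-+ : ∀ m n → ⟦ m + n ⟧ ≡ ⟦ m ⟧ ℚ.+ ⟦ n ⟧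
⟦⟧-homo-+ m n = toℚᵘ-injective (begin
  toℚᵘ ⟦ m + n ⟧                         ≈⟨ toℚᵘ-⟦⟧ (m + n) ⟩
  ℚᵘ.mkℚᵘ (+ (m + n)) 0                  ≈⟨ ℚᵘ.*≡* (trans (cong (ℤ._* + 1) (ℤ.pos-+ m n)) (sum≡ (+ m) (+ n))) ⟩
  ℚᵘ.mkℚᵘ (+ m) 0 ℚᵘ.+ ℚᵘ.mkℚᵘ (+ n) 0  ≈⟨ ℚᵘ.+-cong (toℚᵘ-⟦⟧ m) (toℚᵘ-⟦⟧ n) ⟨
  toℚᵘ ⟦ m ⟧ ℚᵘ.+ toℚᵘ ⟦ n ⟧             ≈⟨ toℚᵘ-homo-+ ⟦ m ⟧ ⟦ n ⟧ ⟨
  toℚᵘ (⟦ m ⟧ ℚ.+ ⟦ n ⟧)                 ∎)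
  where
  open ℚᵘ.≃-Reasoning
  sum≡ : ∀ i j → (i ℤ.+ j) ℤ.* + 1 ≡ (i ℤ.* + 1 ℤ.+ j ℤ.* + 1) ℤ.* + 1
  sum≡ = solve-∀

⟦⟧-homo-* : ∀ m n → ⟦ m * n ⟧ ≡ ⟦ m ⟧ ℚ.* ⟦ n ⟧
⟦⟧-homo-* m n = toℚᵘ-injective (begin
  toℚᵘ ⟦ m * n ⟧                         ≈⟨ toℚᵘ-⟦⟧ (m * n) ⟩
  ℚᵘ.mkℚᵘ (+ (m * n)) 0                  ≈⟨ ℚᵘ.*≡* (cong (ℤ._* + 1) (ℤ.pos-* m n)) ⟩
  ℚᵘ.mkℚᵘ (+ m) 0 ℚᵘ.* ℚᵘ.mkℚᵘ (+ n) 0  ≈⟨ ℚᵘ.*-cong (toℚᵘ-⟦⟧ m) (toℚᵘ-⟦⟧ n) ⟨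
  toℚᵘ ⟦ m ⟧ ℚᵘ.* toℚᵘ ⟦ n ⟧             ≈⟨ toℚᵘ-homo-* ⟦ m ⟧ ⟦ n ⟧ ⟨
  toℚᵘ (⟦ m ⟧ ℚ.* ⟦ n ⟧)                 ∎)
  where open ℚᵘ.≃-Reasoning

x≡c*v⇒x//v≡c : ∀ {x v} c → v ≢ 0ℚ → x ≡ c ℚ.* v → x // v ≡ c
x≡c*v⇒x//v≡c {x} {v} c v≢0 x≡c*v with v ≟ 0ℚ
... | yes v≡0 = ⊥-elim (v≢0 v≡0)
... | no v≢0′ = begin
  x ℚ.* ℚ.1/ v          ≡⟨ cong (ℚ._* ℚ.1/ v) x≡c*v ⟩
  c ℚ.* v ℚ.* ℚ.1/ v    ≡⟨ *-assoc c v (ℚ.1/ v) ⟩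
  c ℚ.* (v ℚ.* ℚ.1/ v)  ≡⟨ cong (c ℚ.*_) (*-inverseʳ v) ⟩
  c ℚ.* 1ℚ              ≡⟨ *-identityʳ c ⟩
  c                     ∎
  where
  open ≡-Reasoning
  instance
    v-nonZero : ℚ.NonZero v
    v-nonZero = ℚ.≢-nonZero v≢0′

*-self-nonNeg : ∀ p → NonNegative (p ℚ.* p)
*-self-nonNeg p with ≤-total 0ℚ p
... | inj₁ 0≤p = let instance _ = ℚ.nonNegative 0≤p in nonNeg*nonNeg⇒nonNeg p p
... | inj₂ p≤0 = let instance _ = ℚ.nonPositive p≤0 in nonPos*nonPos⇒nonPos p p

two : ∀ {n} → Polynomial n
two = con ⟦ 2 ⟧

pellShift : Pair → Pair
pellShift ⟨ a , b ⟩ = ⟨ b , ⟦ 2 ⟧ ℚ.* b ℚ.+ a ⟩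

cassini : Pair → ℚ
cassini ⟨ a , b ⟩ = b ℚ.* b ℚ.- ⟦ 2 ⟧ ℚ.* a ℚ.* b ℚ.- a ℚ.* a

cassini-pellShift² : ∀ x → cassini (pellShift (pellShift x)) ≡ cassini x
cassini-pellShift² ⟨ a , b ⟩ =
  solve 2 (λ a b → let a′ = two :* b :+ a ; b′ = two :* a′ :+ b in
                   b′ :* b′ :- two :* a′ :* b′ :- a′ :* a′ := b :* b :- two :* a :* b :- a :* a)
          refl a b

mediant-⟨1,2⟩ : ∀ x → cassini x ≡ 1ℚ →
  mediant x ⟨ ⟦ 1 ⟧ , ⟦ 2 ⟧ ⟩ ≡ pellShift (pellShift x)
mediant-⟨1,2⟩ ⟨ a , b ⟩ cassini≡1 =
  cong₂ ⟨_,_⟩ (x≡c*v⇒x//v≡c _ d≢0 (sym fst≡)) (x≡c*v⇒x//v≡c _ d≢0 (sym snd≡))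
  where
  d : ℚ
  d = ⟦ 1 ⟧ ℚ.* b ℚ.- a ℚ.* ⟦ 2 ⟧

  fst≡ : (⟦ 2 ⟧ ℚ.* b ℚ.+ a) ℚ.* d ≡ a ℚ.* b ℚ.+ ⟦ 1 ⟧ ℚ.* ⟦ 2 ⟧
  fst≡ = trans
    (solve 2 (λ a b → (two :* b :+ a) :* (con ⟦ 1 ⟧ :* b :- a :* two)
           := a :* b :+ con ⟦ 1 ⟧ :* two
                :* (b :* b :- two :* a :* b :- a :* a)) refl a b)
    (cong (λ t → a ℚ.* b ℚ.+ ⟦ 1 ⟧ ℚ.* ⟦ 2 ⟧ ℚ.* t) cassini≡1)

  snd≡ : (⟦ 2 ⟧ ℚ.* (⟦ 2 ⟧ ℚ.* b ℚ.+ a) ℚ.+ b) ℚ.* d ≡ b ℚ.* b ℚ.+ ⟦ 2 ⟧ ℚ.* ⟦ 2 ⟧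
  snd≡ = trans
    (solve 2 (λ a b → (two :* (two :* b :+ a) :+ b) :* (con ⟦ 1 ⟧ :* b :- a :* two)
           := b :* b :+ two :* two
                :* (b :* b :- two :* a :* b :- a :* a)) refl a b)
    (cong (λ t → b ℚ.* b ℚ.+ ⟦ 2 ⟧ ℚ.* ⟦ 2 ⟧ ℚ.* t) cassini≡1)

  d≢0 : d ≢ 0ℚ
  d≢0 d≡0 = <⇒≢ (positive⁻¹ (1ℚ ℚ.+ a ℚ.* a)) (sym (begin
    1ℚ ℚ.+ a ℚ.* a                 ≡⟨ cong (ℚ._+ a ℚ.* a) cassini≡1 ⟨
    cassini ⟨ a , b ⟩ ℚ.+ a ℚ.* a  ≡⟨ solve 2 (λ a b → (b :* b :- two :* a :* b :- a :* a) :+ a :* a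
                                                 := b :* (con ⟦ 1 ⟧ :* b :- a :* two)) refl a b ⟩
    b ℚ.* d                        ≡⟨ cong (b ℚ.*_) d≡0 ⟩
    b ℚ.* 0ℚ                       ≡⟨ *-zeroʳ b ⟩
    0ℚ                             ∎))
    where
    open ≡-Reasoning
    instance
      a²-nonNeg : NonNegative (a ℚ.* a)
      a²-nonNeg = *-self-nonNeg a
      1+a²-pos : ℚ.Positive (1ℚ ℚ.+ a ℚ.* a)
      1+a²-pos = pos+nonNeg⇒pos 1ℚ (a ℚ.* a)

pellPair : ℕ → Pair
pellPair n = ⟨ ⟦ y n ⟧ , ⟦ y (suc n) ⟧ ⟩

pellPair-suc : ∀ n → pellPair (suc n) ≡ pellShift (pellPair n)
pellPair-suc n = cong ⟨ ⟦ y (suc n) ⟧ ,_⟩ (begin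
  ⟦ 2 * y (suc n) + y n ⟧            ≡⟨ ⟦⟧-homo-+ (2 * y (suc n)) (y n) ⟩
  ⟦ 2 * y (suc n) ⟧ ℚ.+ ⟦ y n ⟧      ≡⟨ cong (ℚ._+ ⟦ y n ⟧) (⟦⟧-homo-* 2 (y (suc n))) ⟩
  ⟦ 2 ⟧ ℚ.* ⟦ y (suc n) ⟧ ℚ.+ ⟦ y n ⟧ ∎)
  where open ≡-Reasoning

pellPair-2*suc : ∀ k → pellPair (2 * suc k) ≡ pellShift (pellShift (pellPair (2 * k)))
pellPair-2*suc k = begin
  pellPair (2 * suc k)                     ≡⟨ cong pellPair (ℕ.*-suc 2 k) ⟩
  pellPair (suc (suc (2 * k)))             ≡⟨ pellPair-suc (suc (2 * k)) ⟩
  pellShift (pellPair (suc (2 * k)))       ≡⟨ cong pellShift (pellPair-suc (2 * k)) ⟩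
  pellShift (pellShift (pellPair (2 * k))) ∎
  where open ≡-Reasoning

cassini-pellPair-even : ∀ k → cassini (pellPair (2 * k)) ≡ 1ℚ
cassini-pellPair-even zero = refl
cassini-pellPair-even (suc k) = begin
  cassini (pellPair (2 * suc k))                     ≡⟨ cong cassini (pellPair-2*suc k) ⟩
  cassini (pellShift (pellShift (pellPair (2 * k)))) ≡⟨ cassini-pellShift² (pellPair (2 * k)) ⟩
  cassini (pellPair (2 * k))                         ≡⟨ cassini-pellPair-even k ⟩
  1ℚ                                                 ∎
  where open ≡-Reasoning

pq≡pellPair : ∀ k → pq k ≡ pellPair (2 * k)
pq≡pellPair zero = refl
pq≡pellPair (suc k) = begin
  mediant (pq k) ⟨ ⟦ 1 ⟧ , ⟦ 2 ⟧ ⟩             ≡⟨ cong (λ x → mediant x ⟨ ⟦ 1 ⟧ , ⟦ 2 ⟧ ⟩) (pq≡pellPair k) ⟩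
  mediant (pellPair (2 * k)) ⟨ ⟦ 1 ⟧ , ⟦ 2 ⟧ ⟩ ≡⟨ mediant-⟨1,2⟩ (pellPair (2 * k)) (cassini-pellPair-even k) ⟩
  pellShift (pellShift (pellPair (2 * k)))     ≡⟨ pellPair-2*suc k ⟨
  pellPair (2 * suc k)                         ∎
  where open ≡-Reasoning

proposition2p4 : (k : ℕ) → 1 ≤ k →
    (p k // q k ≡ ⟦ y (2 * k) ⟧ // ⟦ y (2 * k + 1) ⟧)
    × (p k ≡ ⟦ y (2 * k) ⟧) × (q k ≡ ⟦ y (2 * k + 1) ⟧)
proposition2p4 k _ = cong₂ _//_ p≡ q≡ , p≡ , q≡
  where
  p≡ : p k ≡ ⟦ y (2 * k) ⟧
  p≡ = cong Pair.fst (pq≡pellPair k)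
  q≡ : q k ≡ ⟦ y (2 * k + 1) ⟧
  q≡ = trans (cong Pair.snd (pq≡pellPair k)) (cong (λ n → ⟦ y n ⟧) (ℕ.+-comm 1 (2 * k)))
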